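{- For $1\le k\le n$ let $\mathcal{S}_n^{k\mapsto1}(321,3412)$ be the set of $\sigma\in\mathcal{S}_n(321,3412)$ with $\sigma(k)=1$. For $n>1$, \[ \bigl|\mathcal{S}_n^{1\mapsto1}(321,3412)\bigr| = \bigl|\mathcal{S}_n^{2\mapsto1}(321,3412)\bigr| = F_{2n-3}, \] and for $3\le k\le n$, $\bigl|\mathcal{S}_n^{k\mapsto1}(321,3412)\bigr| = \bigl|\mathcal{S}_{n-1}^{k-1\mapsto1}(321,3412)\bigr|$. Moreover, the generating function $g(x,t)=\sum_{n\ge1}\sum_{k=1}^n \bigl|\mathcal{S}_n^{k\mapsto1}(321,3412)\bigr| t^kx^n$ satisfies \[ g(x,t) = \frac{tx-2tx^2+t^2x^3}{(1-tx)(1-3x+x^2)}. \]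
   Context: $(F_m)$ is the Fibonacci sequence with $F_1=F_2=1$, $F_m=F_{m-1}+F_{m-2}$. Permutations of $[n]$ are written in one-line notation. A permutation $\sigma$ contains a pattern $\tau\in\mathcal{S}_k$ if it has a subsequence $\sigma(i_1),\dots,\sigma(i_k)$ ($i_1<\dots<i_k$) in the same relative order as $\tau$; $\mathcal{S}_n(321,3412)$ is the set of permutations of $[n]$ avoiding both $321$ and $3412$. -}

module Defs where

open import Data.Nat using (ℕ; zero; suc; _+_; _∸_; _≤ᵇ_)
open import Data.Fin using (Fin; toℕ) renaming (_<_ to _<ᶠ_)
import Data.Fin as Fin
open import Data.Vec using (Vec; lookup)
open import Data.Integer as ℤ using (ℤ; +_; 0ℤ; 1ℤ)
open import Data.Product using (Σ; ∃; _×_; _,_)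
open import Data.Bool using (if_then_else_)
open import Data.Empty using (⊥)
open import Relation.Nullary using (¬_)
open import Relation.Binary.PropositionalEquality using (_≡_)
open import Function.Bundles using (_↔_)
open import Data.Refinement using (Refinement)

F : ℕ → ℕ
F zero = 0
F (suc zero) = 1
F (suc (suc m)) = F (suc m) + F m

-- A permutation of [n] in one-line notation: the vector (σ(1),…,σ(n)),
-- with values in Fin n (value i in Fin n stands for i+1), such that
-- σ is injective (hence bijective, as Fin n is finite).
IsPerm : ∀ {n} → Vec (Fin n) n → Set
IsPerm {n} σ = ∀ (i j : Fin n) → lookup σ i ≡ lookup σ j → i ≡ j

Contains : ∀ {n k} → Vec (Fin n) n → Vec (Fin k) k → Set
Contains {n} {k} σ τ =
  Σ (Fin k → Fin n) λ ι →
    (∀ (a b : Fin k) → a <ᶠ b → ι a <ᶠ ι b) ×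
    (∀ (a b : Fin k) → (lookup τ a <ᶠ lookup τ b → lookup σ (ι a) <ᶠ lookup σ (ι b))
                      × (lookup σ (ι a) <ᶠ lookup σ (ι b) → lookup τ a <ᶠ lookup τ b))

Avoids : ∀ {n k} → Vec (Fin n) n → Vec (Fin k) k → Set
Avoids σ τ = ¬ Contains σ τ

-- the patterns 321 and 3412 (values shifted down by one)
p321 : Vec (Fin 3) 3
p321 = Fin.suc (Fin.suc Fin.zero) Data.Vec.∷ Fin.suc Fin.zero Data.Vec.∷ Fin.zero Data.Vec.∷ Data.Vec.[]

p3412 : Vec (Fin 4) 4
p3412 = Fin.suc (Fin.suc Fin.zero) Data.Vec.∷ Fin.suc (Fin.suc (Fin.suc Fin.zero))
        Data.Vec.∷ Fin.zero Data.Vec.∷ Fin.suc Fin.zero Data.Vec.∷ Data.Vec.[]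

-- S_n^{k ↦ 1}(321,3412), for k given as a position in Fin n (position
-- k ∈ Fin n is the (toℕ k + 1)-th entry); value Fin.zero stands for 1.
-- Proofs are irrelevant, so two elements are equal iff their one-line
-- notations are equal.
S : (n : ℕ) → Fin n → Set
S (suc n) k = Refinement (Vec (Fin (suc n)) (suc n)) λ σ →
  IsPerm σ × Avoids σ p321 × Avoids σ p3412 × (lookup σ k ≡ Fin.zero)

-- Two-variable formal power series over ℤ: coefficient of x^N t^K.
FPS : Set
FPS = ℕ → ℕ → ℤ

Σ≤ : ℕ → (ℕ → ℤ) → ℤ
Σ≤ zero f = f 0
Σ≤ (suc n) f = Σ≤ n f ℤ.+ f (suc n)

_⊕_ : FPS → FPS → FPS
(f ⊕ g) N K = f N K ℤ.+ g N K

_⊛_ : FPS → FPS → FPS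
(f ⊛ g) N K = Σ≤ N λ i → Σ≤ K λ j → f i j ℤ.* g (N ∸ i) (K ∸ j)

const : ℤ → FPS
const c zero zero = c
const c _ _ = 0ℤ

X : FPS
X (suc zero) zero = 1ℤ
X _ _ = 0ℤ

T : FPS
T zero (suc zero) = 1ℤ
T _ _ = 0ℤ

infixl 6 _⊕_
infixl 7 _⊛_

gSeries : (ℕ → ℕ → ℕ) → FPS
gSeries a zero K = 0ℤ
gSeries a (suc N) zero = 0ℤ
gSeries a (suc N) (suc K) = if suc K ≤ᵇ suc N then + a (suc N) (suc K) else 0ℤ

-- Deleting the entry 1 from σ ∈ S_n^{1↦1} or S_n^{2↦1} leaves an arbitrary 321- and
-- 3412-avoider of length n-1: an entry 1 in one of the first two positions takes part in
-- no occurrence, since in both patterns the least letter comes third. For k ≥ 3 the first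
-- entry of σ ∈ S_n^{k↦1} is forced to be 2, and deleting it gives S_{n-1}^{k-1↦1}.
-- Hence a_n = |S_n(321,3412)| and u_n = Σ_{k≥2} |S_{n+1}^{k↦1}| satisfy
-- a_{n+1} = a_n + u_n and u_{n+1} = a_{n+1} + u_n, so they are F_{2n-1} and F_{2n}.
-- For the generating function, the shift k ↦ k-1 makes
-- (1 - tx) g = Σ a_n t x^{n+1} + Σ u_n t² x^{n+2}, and 1 - 3x + x² annihilates both
-- columns up to their first terms.

module Submission where

open import Defs
open import Data.Nat using (ℕ; suc; _≤_; _*_; _∸_)
open import Data.Fin using (Fin; zero; fromℕ<; toℕ)
open import Data.Integer using (+_; -_)
open import Data.Product using (_×_; Σ)
open import Relation.Binary.PropositionalEquality using (_≡_)
open import Function.Bundles using (_↔_)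

open import Data.Nat as ℕ using (zero; z≤n; s≤s; _+_; _<ᵇ_)
import Data.Nat.Properties as ℕ
open import Data.Nat.Tactic.RingSolver using (solve-∀)
open import Data.Integer as ℤ using (ℤ; 0ℤ; 1ℤ)
import Data.Integer.Properties as ℤ
import Data.Integer.Tactic.RingSolver as ℤ-Solver
open import Data.Fin as Fin using (suc; _<_; inject₁; punchIn; punchOut)
import Data.Fin.Properties as Fin
open import Data.Fin.Permutation using (↔⇒≡)
open import Data.Vec using (Vec; []; _∷_; lookup; tabulate; map; insertAt; removeAt)
open import Data.Vec.Properties using (lookup∘tabulate; lookup-map; insertAt-lookup; insertAt-punchIn; removeAt-punchOut; insertAt-removeAt)
open import Data.Vec.Relation.Binary.Pointwise.Extensional using (ext; Pointwise-≡⇒≡)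
open import Data.Product using (_,_; proj₁; proj₂; ∃)
open import Data.Product.Function.Dependent.Propositional using (Σ-↔)
open import Data.Sum using (_⊎_; inj₁; inj₂)
open import Data.Sum.Function.Propositional using (_⊎-↔_)
open import Data.Bool as Bool using (true; false)
open import Data.Unit using (tt)
open import Data.Empty using (⊥-elim; ⊥-elim-irr)
open import Data.Refinement using (Refinement; _,_; value; value-injective)
open import Data.Irrelevant using ([_])
open import Relation.Nullary using (yes; no)
open import Relation.Nullary.Decidable using (recompute)
open import Relation.Binary using (tri<; tri≈; tri>)
open import Relation.Binary.Bundles using (Setoid)
import Relation.Binary.Reasoning.Setoid
open import Relation.Binary.PropositionalEquality using (_≢_; refl; sym; trans; cong; cong₂; subst; subst₂; module ≡-Reasoning)
open import Function using (_∘_)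
open import Function.Bundles using (mk↔ₛ′)
open import Function.Properties.Inverse using (↔-refl; ↔-sym; ↔-trans)

OneLine : ℕ → Set
OneLine n = Vec (Fin n) n

StrictlyIncreasing : ∀ {k n} → (Fin k → Fin n) → Set
StrictlyIncreasing f = ∀ a b → a < b → f a < f b

steps⇒strictlyIncreasing : ∀ {k n} {f : Fin (suc k) → Fin n} →
  (∀ a → f (inject₁ a) < f (suc a)) → StrictlyIncreasing f
steps⇒strictlyIncreasing {suc k} steps zero (suc zero) _ = steps zero
steps⇒strictlyIncreasing {suc k} {f = f} steps zero (suc (suc b)) _ =
  ℕ.<-trans (steps zero) (steps⇒strictlyIncreasing {f = f ∘ suc} (steps ∘ suc) zero (suc b) (s≤s z≤n))
steps⇒strictlyIncreasing {suc k} {f = f} steps (suc a) (suc b) (s≤s a<b) =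
  steps⇒strictlyIncreasing {f = f ∘ suc} (steps ∘ suc) a b a<b

strictlyIncreasing-reflects : ∀ {k n} {f : Fin k → Fin n} → StrictlyIncreasing f →
  ∀ a b → f a < f b → a < b
strictlyIncreasing-reflects f↑ a b fa<fb with Fin.<-cmp a b
... | tri< a<b _ _ = a<b
... | tri≈ _ refl _ = ⊥-elim (ℕ.<-irrefl refl fa<fb)
... | tri> _ _ b<a = ⊥-elim (ℕ.<-asym fa<fb (f↑ b a b<a))

punchIn-mono-< : ∀ {n} (i : Fin (suc n)) {j k : Fin n} → j < k → punchIn i j < punchIn i k
punchIn-mono-< i {j} {k} j<k = Fin.≤∧≢⇒< (Fin.punchIn-mono-≤ i j k (ℕ.<⇒≤ j<k))
  (λ eq → Fin.<⇒≢ j<k (Fin.punchIn-injective i j k eq))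

punchIn-cancel-< : ∀ {n} (i : Fin (suc n)) {j k : Fin n} → punchIn i j < punchIn i k → j < k
punchIn-cancel-< i {j} {k} ↑j<↑k = Fin.≤∧≢⇒< (Fin.punchIn-cancel-≤ i j k (ℕ.<⇒≤ ↑j<↑k))
  (λ eq → Fin.<⇒≢ ↑j<↑k (cong (punchIn i) eq))

preimage : ∀ {n} (σ : OneLine n) → .(IsPerm σ) → ∀ v → ∃ λ i → lookup σ i ≡ v
preimage {suc n} σ σ-inj v with Fin.any? (λ i → lookup σ i Fin.≟ v)
... | yes found = found
... | no missing = ⊥-elim-irr (ℕ.<-irrefl refl (Fin.injective⇒≤ {f = squeeze}
  λ {i} {j} eq → σ-inj i j (Fin.punchOut-injective (v≢σ i) (v≢σ j) eq)))
  where
  v≢σ : ∀ i → v ≢ lookup σ i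
  v≢σ i eq = missing (i , sym eq)
  squeeze : Fin (suc n) → Fin n
  squeeze i = punchOut (v≢σ i)

≢0⇒0< : ∀ {n} {x : Fin (suc n)} → x ≢ zero → zero {n} < x
≢0⇒0< {x = zero} x≢0 = ⊥-elim (x≢0 refl)
≢0⇒0< {x = suc _} _ = s≤s z≤n

≢0∧≢1⇒1< : ∀ {n} {x : Fin (2 + n)} → x ≢ zero → x ≢ suc zero → suc (zero {n}) < x
≢0∧≢1⇒1< {x = zero} x≢0 _ = ⊥-elim (x≢0 refl)
≢0∧≢1⇒1< {x = suc zero} _ x≢1 = ⊥-elim (x≢1 refl)
≢0∧≢1⇒1< {x = suc (suc _)} _ _ = s≤s (s≤s z≤n)

unique-position : ∀ {n} (σ : OneLine n) → IsPerm σ → ∀ {i j v} → lookup σ j ≡ v → i ≢ j → lookup σ i ≢ v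
unique-position σ σ-inj σj≡v i≢j σi≡v = i≢j (σ-inj _ _ (trans σi≡v (sym σj≡v)))

occurrence : ∀ {n k} (σ : OneLine n) {π π⁻¹ : Vec (Fin (suc k)) (suc k)} →
  (∀ a → lookup π⁻¹ (lookup π a) ≡ a) → (ι : Fin (suc k) → Fin n) →
  (∀ a → ι (inject₁ a) < ι (suc a)) →
  (∀ r → lookup σ (ι (lookup π⁻¹ (inject₁ r))) < lookup σ (ι (lookup π⁻¹ (suc r)))) →
  Contains σ π
occurrence σ {π} {π⁻¹} inverse ι ι-steps value-steps =
  ι , steps⇒strictlyIncreasing ι-steps , λ a b → forward a b , backward a b
  where
  h : _ → Fin _
  h r = lookup σ (ι (lookup π⁻¹ r))
  h↑ : StrictlyIncreasing h
  h↑ = steps⇒strictlyIncreasing value-steps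
  h∘π : ∀ a → h (lookup π a) ≡ lookup σ (ι a)
  h∘π a = cong (lookup σ ∘ ι) (inverse a)
  forward : ∀ a b → lookup π a < lookup π b → lookup σ (ι a) < lookup σ (ι b)
  forward a b = subst₂ _<_ (h∘π a) (h∘π b) ∘ h↑ _ _
  backward : ∀ a b → lookup σ (ι a) < lookup σ (ι b) → lookup π a < lookup π b
  backward a b = strictlyIncreasing-reflects h↑ _ _ ∘ subst₂ _<_ (sym (h∘π a)) (sym (h∘π b))

-- Both patterns are involutions, so each serves as its own inverse.
321-occurrence : ∀ {n} (σ : OneLine n) {i j l} → i < j → j < l →
  lookup σ l < lookup σ j → lookup σ j < lookup σ i → Contains σ p321
321-occurrence σ {i} {j} {l} i<j j<l σl<σj σj<σi =
  occurrence σ {p321} {p321} (λ { zero → refl ; (suc zero) → refl ; (suc (suc zero)) → refl })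
    (lookup (i ∷ j ∷ l ∷ []))
    (λ { zero → i<j ; (suc zero) → j<l })
    (λ { zero → σl<σj ; (suc zero) → σj<σi })

3412-occurrence : ∀ {n} (σ : OneLine n) {i j l r} → i < j → j < l → l < r →
  lookup σ l < lookup σ r → lookup σ r < lookup σ i → lookup σ i < lookup σ j → Contains σ p3412
3412-occurrence σ {i} {j} {l} {r} i<j j<l l<r σl<σr σr<σi σi<σj =
  occurrence σ {p3412} {p3412}
    (λ { zero → refl ; (suc zero) → refl ; (suc (suc zero)) → refl ; (suc (suc (suc zero))) → refl })
    (lookup (i ∷ j ∷ l ∷ r ∷ []))
    (λ { zero → i<j ; (suc zero) → j<l ; (suc (suc zero)) → l<r })
    (λ { zero → σl<σr ; (suc zero) → σr<σi ; (suc (suc zero)) → σi<σj })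

-- Removing and inserting an entry

remove : ∀ {n} (σ : OneLine (suc n)) (p : Fin (suc n)) → .(IsPerm σ) → OneLine n
remove σ p σ-inj = tabulate λ j →
  punchOut {i = lookup σ p} (λ eq → ⊥-elim-irr (Fin.punchInᵢ≢i p j (sym (σ-inj _ _ eq))))

punchIn-remove : ∀ {n} (σ : OneLine (suc n)) p .(σ-inj : IsPerm σ) j →
  punchIn (lookup σ p) (lookup (remove σ p σ-inj) j) ≡ lookup σ (punchIn p j)
punchIn-remove σ p σ-inj j =
  trans (cong (punchIn (lookup σ p)) (lookup∘tabulate _ j)) (Fin.punchIn-punchOut _)

insert : ∀ {n} (τ : OneLine n) (p v : Fin (suc n)) → OneLine (suc n)
insert τ p v = insertAt (map (punchIn v) τ) p v

insert-lookup : ∀ {n} (τ : OneLine n) p v → lookup (insert τ p v) p ≡ v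
insert-lookup τ p v = insertAt-lookup (map (punchIn v) τ) p v

insert-punchIn : ∀ {n} (τ : OneLine n) p v j →
  lookup (insert τ p v) (punchIn p j) ≡ punchIn v (lookup τ j)
insert-punchIn τ p v j = trans (insertAt-punchIn _ p v j) (lookup-map j (punchIn v) τ)

lookup-removeAt : ∀ {n} {A : Set} (xs : Vec A (suc n)) p j →
  lookup (removeAt xs p) j ≡ lookup xs (punchIn p j)
lookup-removeAt xs p j =
  trans (cong (lookup (removeAt xs p)) (sym (Fin.punchOut-punchIn p))) (removeAt-punchOut xs _)

remove-insert : ∀ {n} (τ : OneLine n) p v .(inj : IsPerm (insert τ p v)) →
  remove (insert τ p v) p inj ≡ τ
remove-insert τ p v inj = Pointwise-≡⇒≡ (ext λ j → Fin.punchIn-injective v _ _ (begin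
  punchIn v (lookup (remove σ p inj) j)             ≡⟨ cong (λ w → punchIn w (lookup (remove σ p inj) j)) (sym (insert-lookup τ p v)) ⟩
  punchIn (lookup σ p) (lookup (remove σ p inj) j)  ≡⟨ punchIn-remove σ p inj j ⟩
  lookup σ (punchIn p j)                            ≡⟨ insert-punchIn τ p v j ⟩
  punchIn v (lookup τ j)                            ∎))
  where
  open ≡-Reasoning
  σ = insert τ p v

insert-remove : ∀ {n} (σ : OneLine (suc n)) p .(inj : IsPerm σ) →
  insert (remove σ p inj) p (lookup σ p) ≡ σ
insert-remove σ p inj = trans (cong (λ xs → insertAt xs p (lookup σ p)) punched) (insertAt-removeAt σ p)
  where
  punched : map (punchIn (lookup σ p)) (remove σ p inj) ≡ removeAt σ p
  punched = Pointwise-≡⇒≡ (ext λ j →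
    trans (lookup-map j (punchIn (lookup σ p)) (remove σ p inj)) (trans (punchIn-remove σ p inj j) (sym (lookup-removeAt σ p j))))

punchIn-view : ∀ {n} (p i : Fin (suc n)) → i ≡ p ⊎ ∃ λ j → i ≡ punchIn p j
punchIn-view p i with p Fin.≟ i
... | yes p≡i = inj₁ (sym p≡i)
... | no p≢i  = inj₂ (punchOut p≢i , sym (Fin.punchIn-punchOut p≢i))

remove-isPerm : ∀ {n} (σ : OneLine (suc n)) p .(inj : IsPerm σ) → IsPerm σ → IsPerm (remove σ p inj)
remove-isPerm σ p inj σ-inj j k eq = Fin.punchIn-injective p j k (σ-inj _ _ (begin
  lookup σ (punchIn p j)                            ≡⟨ sym (punchIn-remove σ p inj j) ⟩
  punchIn (lookup σ p) (lookup (remove σ p inj) j)  ≡⟨ cong (punchIn (lookup σ p)) eq ⟩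
  punchIn (lookup σ p) (lookup (remove σ p inj) k)  ≡⟨ punchIn-remove σ p inj k ⟩
  lookup σ (punchIn p k)                            ∎))
  where open ≡-Reasoning

insert-isPerm : ∀ {n} (τ : OneLine n) p v → IsPerm τ → IsPerm (insert τ p v)
insert-isPerm τ p v τ-inj i k eq with punchIn-view p i | punchIn-view p k
... | inj₁ refl | inj₁ refl = refl
... | inj₁ refl | inj₂ (j , refl) = ⊥-elim (Fin.punchInᵢ≢i v (lookup τ j)
  (trans (sym (insert-punchIn τ p v j)) (trans (sym eq) (insert-lookup τ p v))))
... | inj₂ (j , refl) | inj₁ refl = ⊥-elim (Fin.punchInᵢ≢i v (lookup τ j)
  (trans (sym (insert-punchIn τ p v j)) (trans eq (insert-lookup τ p v))))
... | inj₂ (j , refl) | inj₂ (j′ , refl) = cong (punchIn p) (τ-inj j j′ (Fin.punchIn-injective v _ _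
  (trans (sym (insert-punchIn τ p v j)) (trans eq (insert-punchIn τ p v j′)))))

Contains-transfer : ∀ {n n′ k} (σ : OneLine n) (σ′ : OneLine n′) (π : Vec (Fin k) k)
  (occ : Contains σ π) (ι′ : Fin k → Fin n′) → let ι = proj₁ occ in
  (∀ a b → ι a < ι b → ι′ a < ι′ b) →
  (∀ a b → lookup σ (ι a) < lookup σ (ι b) → lookup σ′ (ι′ a) < lookup σ′ (ι′ b)) →
  (∀ a b → lookup σ′ (ι′ a) < lookup σ′ (ι′ b) → lookup σ (ι a) < lookup σ (ι b)) →
  Contains σ′ π
Contains-transfer _ _ _ (ι , ι↑ , vals) ι′ positions values⁺ values⁻ =
  ι′ , (λ a b → positions a b ∘ ι↑ a b) , λ a b → values⁺ a b ∘ proj₁ (vals a b) , proj₂ (vals a b) ∘ values⁻ a b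

Contains-remove⁻ : ∀ {n k} (σ : OneLine (suc n)) p .(inj : IsPerm σ) {π : Vec (Fin k) k} →
  Contains (remove σ p inj) π → Contains σ π
Contains-remove⁻ σ p inj {π} occ@(ι , _) = Contains-transfer (remove σ p inj) σ π occ (punchIn p ∘ ι)
  (λ _ _ → punchIn-mono-< p)
  (λ a b → subst₂ _<_ (spec a) (spec b) ∘ punchIn-mono-< (lookup σ p))
  (λ a b → punchIn-cancel-< (lookup σ p) ∘ subst₂ _<_ (sym (spec a)) (sym (spec b)))
  where
  spec : ∀ a → _
  spec a = punchIn-remove σ p inj (ι a)

Inert : ∀ {n k} → OneLine n → Vec (Fin k) k → Fin n → Set
Inert σ π p = (occ : Contains σ π) → ∀ a → proj₁ occ a ≢ p

Contains-remove⁺ : ∀ {n k} (σ : OneLine (suc n)) p .(inj : IsPerm σ) {π : Vec (Fin k) k} →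
  (occ : Contains σ π) → (∀ a → proj₁ occ a ≢ p) → Contains (remove σ p inj) π
Contains-remove⁺ σ p inj {π} occ@(ι , _) misses = Contains-transfer σ (remove σ p inj) π occ ι′
  (λ a b → punchIn-cancel-< p ∘ subst₂ _<_ (sym (position a)) (sym (position b)))
  (λ a b → punchIn-cancel-< (lookup σ p) ∘ subst₂ _<_ (sym (entry a)) (sym (entry b)))
  (λ a b → subst₂ _<_ (entry a) (entry b) ∘ punchIn-mono-< (lookup σ p))
  where
  ι′ : _ → _
  ι′ a = punchOut (misses a ∘ sym)
  position : ∀ a → punchIn p (ι′ a) ≡ ι a
  position a = Fin.punchIn-punchOut (misses a ∘ sym)
  entry : ∀ a → punchIn (lookup σ p) (lookup (remove σ p inj) (ι′ a)) ≡ lookup σ (ι a)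
  entry a = trans (punchIn-remove σ p inj (ι′ a)) (cong (lookup σ) (position a))

Avoids-remove : ∀ {n k} (σ : OneLine (suc n)) p .(inj : IsPerm σ) {π : Vec (Fin k) k} →
  Avoids σ π → Avoids (remove σ p inj) π
Avoids-remove σ p inj {π} σ-avoids = σ-avoids ∘ Contains-remove⁻ σ p inj {π}

Avoids-insert : ∀ {n k} (τ : OneLine n) p v {π : Vec (Fin k) k} → IsPerm τ →
  Avoids τ π → Inert (insert τ p v) π p → Avoids (insert τ p v) π
Avoids-insert τ p v {π} τ-inj τ-avoids inert occ = τ-avoids
  (subst (λ ρ → Contains ρ π) (remove-insert τ p v inj) (Contains-remove⁺ (insert τ p v) p inj {π} occ (inert occ)))
  where inj = insert-isPerm τ p v τ-inj

two : ∀ {k} → Fin (3 + k)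
two = suc (suc zero)

least-inert : ∀ {n k} (σ : OneLine (suc n)) (π : Vec (Fin (3 + k)) (3 + k)) {p} →
  lookup σ p ≡ zero → toℕ p ≤ 1 → (∀ a → a ≢ two → lookup π two < lookup π a) → Inert σ π p
least-inert σ π σp≡0 p≤1 π-least (ι , ι↑ , vals) a ιa≡p with a Fin.≟ two
... | yes refl = ℕ.<⇒≱ (s≤s p≤1) (subst (λ i → 2 ≤ toℕ i) ιa≡p 2≤ι₂)
  where
  2≤ι₂ : 2 ≤ toℕ (ι two)
  2≤ι₂ = ℕ.≤-trans (s≤s (ℕ.≤-trans (s≤s z≤n) (ι↑ zero (suc zero) (s≤s z≤n)))) (ι↑ (suc zero) two (s≤s (s≤s z≤n)))
... | no a≢two = ℕ.n≮0 (subst (λ i → lookup σ (ι two) < i) (trans (cong (lookup σ) ιa≡p) σp≡0)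
  (proj₁ (vals two a) (π-least a a≢two)))

second-least-front-inert : ∀ {n k} (σ : OneLine (2 + n)) (π : Vec (Fin (suc k)) (suc k)) {b c} →
  lookup σ zero ≡ suc zero → lookup π c < lookup π b → lookup π b < lookup π zero → Inert σ π zero
second-least-front-inert σ π {b} {c} σ0≡1 πc<πb πb<π0 (ι , ι↑ , vals) zero ι0≡0 =
  ℕ.n≮0 (ℕ.<-≤-trans (proj₁ (vals c b) πc<πb) (ℕ.≤-pred σιb<1))
  where
  σιb<1 : toℕ (lookup σ (ι b)) ℕ.< 1
  σιb<1 = subst (λ i → lookup σ (ι b) < i) (trans (cong (lookup σ) ι0≡0) σ0≡1) (proj₁ (vals b zero) πb<π0)
second-least-front-inert σ π σ0≡1 πc<πb πb<π0 (ι , ι↑ , vals) (suc a) ιa≡0 =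
  ℕ.n≮0 (subst (λ i → ι zero < i) ιa≡0 (ι↑ zero (suc a) (s≤s z≤n)))

p321-least : ∀ a → a ≢ two → lookup p321 two < lookup p321 a
p321-least zero _ = s≤s z≤n
p321-least (suc zero) _ = s≤s z≤n
p321-least (suc (suc zero)) a≢two = ⊥-elim (a≢two refl)

p3412-least : ∀ a → a ≢ two → lookup p3412 two < lookup p3412 a
p3412-least zero _ = s≤s z≤n
p3412-least (suc zero) _ = s≤s z≤n
p3412-least (suc (suc zero)) a≢two = ⊥-elim (a≢two refl)
p3412-least (suc (suc (suc zero))) _ = s≤s z≤n

IsAvoider : ∀ {n} → OneLine n → Set
IsAvoider σ = IsPerm σ × Avoids σ p321 × Avoids σ p3412

Av : ℕ → Set
Av n = Refinement (OneLine n) IsAvoider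

Pinned : ∀ {n} → Fin (suc n) → OneLine (suc n) → Set
Pinned k σ = IsPerm σ × Avoids σ p321 × Avoids σ p3412 × (lookup σ k ≡ zero)

pin : ∀ {n} (σ : OneLine (suc n)) k → IsAvoider σ → lookup σ k ≡ zero → Pinned k σ
pin _ _ (σ-inj , av321 , av3412) σk≡0 = σ-inj , av321 , av3412 , σk≡0

unpin : ∀ {n k} (σ : OneLine (suc n)) → Pinned k σ → IsAvoider σ
unpin _ (σ-inj , av321 , av3412 , _) = σ-inj , av321 , av3412

pinned-at : ∀ {n k} (σ : OneLine (suc n)) → Pinned k σ → lookup σ k ≡ zero
pinned-at _ (_ , _ , _ , σk≡0) = σk≡0

-- Otherwise σ(1) σ(2) 1 is a 321, or, with 2 at position r, so is σ(1) 2 1 when r comes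
-- before the 1, and σ(1) σ(2) 1 2 is a 3412 when r comes after it.
front-is-2 : ∀ {m} (σ : OneLine (2 + m)) (k : Fin m) → Pinned (suc (suc k)) σ → lookup σ zero ≡ suc zero
front-is-2 {m} σ k (σ-inj , av321 , av3412 , σq≡0) with lookup σ zero Fin.≟ suc zero
... | yes σ0≡1 = σ0≡1
... | no σ0≢1 with Fin.<-cmp (lookup σ (suc zero)) (lookup σ zero) | preimage σ σ-inj (suc zero)
                  | ≢0∧≢1⇒1< {m} (unique-position σ σ-inj σq≡0 (λ ())) σ0≢1
...   | tri< σ1<σ0 _ _ | _ | _ = ⊥-elim (av321 (321-occurrence σ (s≤s z≤n) (s≤s (s≤s z≤n))
        (subst (_< lookup σ (suc zero)) (sym σq≡0) (≢0⇒0< (unique-position σ σ-inj σq≡0 (λ ())))) σ1<σ0))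
...   | tri≈ _ σ1≡σ0 _ | _ | _ with () ← σ-inj _ _ σ1≡σ0
...   | tri> _ _ σ0<σ1 | r , σr≡1 | 1<σ0 with Fin.<-cmp r (suc (suc k))
...     | tri< r<q _ _ = ⊥-elim (av321 (321-occurrence σ (≢0⇒0< r≢0) r<q
          (subst₂ _<_ (sym σq≡0) (sym σr≡1) (s≤s z≤n)) (subst (_< lookup σ zero) (sym σr≡1) 1<σ0)))
  where
  r≢0 : r ≢ zero
  r≢0 refl = σ0≢1 σr≡1
...     | tri≈ _ refl _ with () ← trans (sym σr≡1) σq≡0
...     | tri> _ _ q<r = ⊥-elim (av3412 (3412-occurrence σ (s≤s z≤n) (s≤s (s≤s z≤n)) q<r
          (subst₂ _<_ (sym σq≡0) (sym σr≡1) (s≤s z≤n)) (subst (_< lookup σ zero) (sym σr≡1) 1<σ0) σ0<σ1))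

remove-↔ : ∀ {n} (p v : Fin (suc n)) {P : OneLine (suc n) → Set} {Q : OneLine n → Set} →
  (P⇒isPerm : ∀ {σ} → P σ → IsPerm σ) → (∀ {σ} → P σ → lookup σ p ≡ v) →
  (∀ {σ} (Pσ : P σ) → Q (remove σ p (P⇒isPerm Pσ))) → (∀ {τ} → Q τ → P (insert τ p v)) →
  Refinement (OneLine (suc n)) P ↔ Refinement (OneLine n) Q
remove-↔ p v P⇒isPerm P⇒at remove-Q insert-P = mk↔ₛ′
  (λ { (σ , [ Pσ ]) → remove σ p (P⇒isPerm Pσ) , [ remove-Q Pσ ] })
  (λ { (τ , [ Qτ ]) → insert τ p v , [ insert-P Qτ ] })
  (λ { (τ , [ Qτ ]) → value-injective (remove-insert τ p v (P⇒isPerm (insert-P Qτ))) })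
  (λ { (σ , [ Pσ ]) → value-injective (trans (cong (insert _ p) (sym (recompute (_ Fin.≟ v) (P⇒at Pσ))))
                                              (insert-remove σ p (P⇒isPerm Pσ))) })

IsAvoider-remove : ∀ {n} (σ : OneLine (suc n)) p .(inj : IsPerm σ) → IsAvoider σ → IsAvoider (remove σ p inj)
IsAvoider-remove σ p inj (σ-inj , av321 , av3412) =
  remove-isPerm σ p inj σ-inj , Avoids-remove σ p inj {p321} av321 , Avoids-remove σ p inj {p3412} av3412

IsAvoider-insert : ∀ {n} (τ : OneLine n) p v → IsAvoider τ →
  Inert (insert τ p v) p321 p → Inert (insert τ p v) p3412 p → IsAvoider (insert τ p v)
IsAvoider-insert τ p v (τ-inj , av321 , av3412) inert321 inert3412 =
  insert-isPerm τ p v τ-inj , Avoids-insert τ p v {p321} τ-inj av321 inert321 ,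
  Avoids-insert τ p v {p3412} τ-inj av3412 inert3412

IsAvoider-insert-1 : ∀ {n} (τ : OneLine n) p → toℕ p ≤ 1 → IsAvoider τ → IsAvoider (insert τ p zero)
IsAvoider-insert-1 τ p p≤1 τ-avoider = IsAvoider-insert τ p zero τ-avoider
  (least-inert (insert τ p zero) p321 (insert-lookup τ p zero) p≤1 p321-least)
  (least-inert (insert τ p zero) p3412 (insert-lookup τ p zero) p≤1 p3412-least)

IsAvoider-insert-2-front : ∀ {n} (τ : OneLine (suc n)) → IsAvoider τ → IsAvoider (insert τ zero (suc zero))
IsAvoider-insert-2-front τ τ-avoider = IsAvoider-insert τ zero (suc zero) τ-avoider
  (second-least-front-inert σ p321 {suc zero} {two} (insert-lookup τ zero (suc zero)) (s≤s z≤n) (s≤s (s≤s z≤n)))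
  (second-least-front-inert σ p3412 {suc two} {two} (insert-lookup τ zero (suc zero)) (s≤s z≤n) (s≤s (s≤s z≤n)))
  where σ = insert τ zero (suc zero)

S-at-1↔Av : ∀ n → S (suc n) zero ↔ Av n
S-at-1↔Av n = remove-↔ zero zero proj₁ (λ {σ} → pinned-at σ)
  (λ {σ} Pσ → IsAvoider-remove σ zero (proj₁ Pσ) (unpin σ Pσ))
  (λ {τ} τ-avoider → pin (insert τ zero zero) zero
     (IsAvoider-insert-1 τ zero z≤n τ-avoider) (insert-lookup τ zero zero))

S-at-2↔Av : ∀ n → S (2 + n) (suc zero) ↔ Av (suc n)
S-at-2↔Av n = remove-↔ (suc zero) zero proj₁ (λ {σ} → pinned-at σ)
  (λ {σ} Pσ → IsAvoider-remove σ (suc zero) (proj₁ Pσ) (unpin σ Pσ))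
  (λ {τ} τ-avoider → pin (insert τ (suc zero) zero) (suc zero)
     (IsAvoider-insert-1 τ (suc zero) (s≤s z≤n) τ-avoider) (insert-lookup τ (suc zero) zero))

remove-front-2 : ∀ {n} (σ : OneLine (2 + n)) .(inj : IsPerm σ) j →
  lookup σ zero ≡ suc zero → lookup σ (suc j) ≡ zero → lookup (remove σ zero inj) j ≡ zero
remove-front-2 σ inj j σ0≡1 σj≡0 = punchIn-1-inverse (begin
  punchIn (suc zero) (lookup (remove σ zero inj) j)    ≡⟨ cong (λ w → punchIn w (lookup (remove σ zero inj) j)) (sym σ0≡1) ⟩
  punchIn (lookup σ zero) (lookup (remove σ zero inj) j) ≡⟨ punchIn-remove σ zero inj j ⟩
  lookup σ (suc j)                                       ≡⟨ σj≡0 ⟩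
  zero                                                   ∎)
  where
  open ≡-Reasoning
  punchIn-1-inverse : ∀ {n} {x : Fin (suc n)} → punchIn (suc zero) x ≡ zero → x ≡ zero
  punchIn-1-inverse {x = zero} _ = refl

S-shift-↔ : ∀ m (k : Fin m) → S (2 + m) (suc (suc k)) ↔ S (suc m) (suc k)
S-shift-↔ m k = remove-↔ zero (suc zero) proj₁ (λ {σ} → front-is-2 σ k)
  (λ {σ} Pσ → pin (remove σ zero (proj₁ Pσ)) (suc k) (IsAvoider-remove σ zero (proj₁ Pσ) (unpin σ Pσ))
     (remove-front-2 σ (proj₁ Pσ) (suc k) (front-is-2 σ k Pσ) (pinned-at σ Pσ)))
  (λ {τ} Pτ → pin (insert τ zero (suc zero)) (suc (suc k)) (IsAvoider-insert-2-front τ (unpin τ Pτ))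
     (trans (insert-punchIn τ zero (suc zero) (suc k)) (cong (punchIn (suc zero)) (pinned-at τ Pτ))))

-- Counting

U : ℕ → Set
U n = Σ (Fin n) λ k → S (suc n) (suc k)

Σ-Fin-suc : ∀ {n} (P : Fin (suc n) → Set) → Σ (Fin (suc n)) P ↔ (P zero ⊎ Σ (Fin n) (P ∘ suc))
Σ-Fin-suc P = mk↔ₛ′
  (λ { (zero , x) → inj₁ x ; (suc k , x) → inj₂ (k , x) })
  (λ { (inj₁ x) → zero , x ; (inj₂ (k , x)) → suc k , x })
  (λ { (inj₁ x) → refl ; (inj₂ (k , x)) → refl })
  (λ { (zero , x) → refl ; (suc k , x) → refl })

Av↔S : ∀ n → Av (suc n) ↔ Σ (Fin (suc n)) (S (suc n))
Av↔S n = mk↔ₛ′ locate forget locate∘forget (λ _ → refl)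
  where
  locate : Av (suc n) → Σ (Fin (suc n)) (S (suc n))
  locate (σ , [ σ-avoider ]) =
    let (k , σk≡0) = preimage σ (proj₁ σ-avoider) zero in k , (σ , [ pin σ k σ-avoider σk≡0 ])
  forget : Σ (Fin (suc n)) (S (suc n)) → Av (suc n)
  forget (_ , (σ , [ Pσ ])) = σ , [ unpin σ Pσ ]
  locate∘forget : ∀ x → locate (forget x) ≡ x
  locate∘forget (k , (σ , [ Pσ ])) = same-position (recompute (_ Fin.≟ k)
    (proj₁ Pσ _ k (trans (proj₂ (preimage σ (proj₁ Pσ) zero)) (sym (pinned-at σ Pσ)))))
    refl
    where
    same-position : ∀ {k′} {x : S (suc n) k′} {y : S (suc n) k} → k′ ≡ k → value x ≡ value y → (k′ , x) ≡ (k , y)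
    same-position refl e = cong (k ,_) (value-injective e)

Av-suc-↔ : ∀ n → Av (suc n) ↔ (Av n ⊎ U n)
Av-suc-↔ n = ↔-trans (Av↔S n) (↔-trans (Σ-Fin-suc (S (suc n))) (S-at-1↔Av n ⊎-↔ ↔-refl))

U-suc-↔ : ∀ n → U (suc n) ↔ (Av (suc n) ⊎ U n)
U-suc-↔ n = ↔-trans (Σ-Fin-suc _) (S-at-2↔Av n ⊎-↔ Σ-↔ ↔-refl (S-shift-↔ n _))

Av-0 : Fin 1 ↔ Av 0
Av-0 = mk↔ₛ′ (λ _ → [] , [ (λ ()) , nonempty-pattern {π = p321} , nonempty-pattern {π = p3412} ]) (λ _ → zero)
  (λ { ([] , _) → refl }) (λ { zero → refl })
  where
  nonempty-pattern : ∀ {k} {π : Vec (Fin (suc k)) (suc k)} → Avoids [] π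
  nonempty-pattern (ι , _) with () ← ι zero

mutual
  #Av : ℕ → ℕ
  #Av zero = 1
  #Av (suc n) = #Av n + #U n

  #U : ℕ → ℕ
  #U zero = 0
  #U (suc n) = #Av (suc n) + #U n

mutual
  Av-count : ∀ n → Fin (#Av n) ↔ Av n
  Av-count zero = Av-0
  Av-count (suc n) = ↔-trans Fin.+↔⊎ (↔-trans (Av-count n ⊎-↔ U-count n) (↔-sym (Av-suc-↔ n)))

  U-count : ∀ n → Fin (#U n) ↔ U n
  U-count zero = mk↔ₛ′ (λ ()) (λ ()) (λ ()) (λ ())
  U-count (suc n) = ↔-trans Fin.+↔⊎ (↔-trans (Av-count (suc n) ⊎-↔ U-count n) (↔-sym (U-suc-↔ n)))

double-suc : ∀ n → suc n + suc n ≡ suc (suc (n + n))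
double-suc n = cong suc (ℕ.+-suc n n)

mutual
  #Av≡F : ∀ n → #Av (suc n) ≡ F (suc (n + n))
  #Av≡F zero = refl
  #Av≡F (suc n) = begin
    #Av (suc n) + #U (suc n)                  ≡⟨ cong₂ _+_ (#Av≡F n) (#U≡F (suc n)) ⟩
    F (suc (n + n)) + F (suc n + suc n)       ≡⟨ cong (λ i → F (suc (n + n)) + F i) (double-suc n) ⟩
    F (suc (n + n)) + F (suc (suc (n + n)))   ≡⟨ ℕ.+-comm (F (suc (n + n))) _ ⟩
    F (suc (suc (suc (n + n))))               ≡⟨ cong (F ∘ suc) (sym (double-suc n)) ⟩
    F (suc (suc n + suc n))                   ∎
    where open ≡-Reasoning

  #U≡F : ∀ n → #U n ≡ F (n + n)
  #U≡F zero = refl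
  #U≡F (suc n) = trans (cong₂ _+_ (#Av≡F n) (#U≡F n)) (cong F (sym (double-suc n)))

Av-count-F : ∀ m → Fin (F (2 * suc (suc m) ∸ 3)) ↔ Av (suc m)
Av-count-F m = subst (λ c → Fin c ↔ Av (suc m)) (trans (#Av≡F m) (cong F (sym index))) (Av-count (suc m))
  where
  index : 2 * suc (suc m) ∸ 3 ≡ suc (m + m)
  index = cong (_∸ 3) (doubled m)
    where
    doubled : ∀ m → 2 * suc (suc m) ≡ 4 + (m + m)
    doubled = solve-∀

-- Formal power series

-- A record rather than a function type, so that Agda infers series from ≐-types instead
-- of unfolding them into their coefficients.
infix 4 _≐_
record _≐_ (f g : FPS) : Set where
  field coeff : ∀ N K → f N K ≡ g N K
open _≐_

≐-setoid : Setoid _ _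
≐-setoid = record
  { Carrier = FPS
  ; _≈_ = _≐_
  ; isEquivalence = record
    { refl = λ where .coeff _ _ → refl
    ; sym = λ f≐g → λ where .coeff N K → sym (coeff f≐g N K)
    ; trans = λ f≐g g≐h → λ where .coeff N K → trans (coeff f≐g N K) (coeff g≐h N K)
    }
  }

infixr 8 x·_ t·_ _◃_

x·_ : FPS → FPS
(x· f) zero K = 0ℤ
(x· f) (suc N) K = f N K

t·_ : FPS → FPS
(t· f) N zero = 0ℤ
(t· f) N (suc K) = f N K

_◃_ : ℤ → FPS → FPS
(c ◃ f) N K = c ℤ.* f N K

x·-cong : ∀ {f g} → f ≐ g → x· f ≐ x· g
x·-cong f≐g .coeff zero K = refl
x·-cong f≐g .coeff (suc N) K = coeff f≐g N K

t·-cong : ∀ {f g} → f ≐ g → t· f ≐ t· g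
t·-cong f≐g .coeff N zero = refl
t·-cong f≐g .coeff N (suc K) = coeff f≐g N K

◃-cong : ∀ c {f g} → f ≐ g → c ◃ f ≐ c ◃ g
◃-cong c f≐g .coeff N K = cong (c ℤ.*_) (coeff f≐g N K)

⊕-cong : ∀ {f f′ g g′} → f ≐ f′ → g ≐ g′ → f ⊕ g ≐ f′ ⊕ g′
⊕-cong f≐f′ g≐g′ .coeff N K = cong₂ ℤ._+_ (coeff f≐f′ N K) (coeff g≐g′ N K)

Σ≤-cong : ∀ n {f g : ℕ → ℤ} → (∀ i → i ≤ n → f i ≡ g i) → Σ≤ n f ≡ Σ≤ n g
Σ≤-cong zero f≡g = f≡g 0 z≤n
Σ≤-cong (suc n) f≡g = cong₂ ℤ._+_ (Σ≤-cong n λ i i≤n → f≡g i (ℕ.m≤n⇒m≤1+n i≤n)) (f≡g (suc n) ℕ.≤-refl)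

Σ≤-zero : ∀ n {f : ℕ → ℤ} → (∀ i → i ≤ n → f i ≡ 0ℤ) → Σ≤ n f ≡ 0ℤ
Σ≤-zero n f≡0 = trans (Σ≤-cong n f≡0) (zeros n)
  where
  zeros : ∀ n → Σ≤ n (λ _ → 0ℤ) ≡ 0ℤ
  zeros zero = refl
  zeros (suc n) = cong (ℤ._+ 0ℤ) (zeros n)

Σ≤-last : ∀ n {f : ℕ → ℤ} → (∀ i → i ℕ.< n → f i ≡ 0ℤ) → Σ≤ n f ≡ f n
Σ≤-last zero _ = refl
Σ≤-last (suc n) {f} f≡0 =
  trans (cong (ℤ._+ f (suc n)) (Σ≤-zero n λ i i≤n → f≡0 i (s≤s i≤n))) (ℤ.+-identityˡ (f (suc n)))

Σ≤-+ : ∀ n (f g : ℕ → ℤ) → Σ≤ n (λ i → f i ℤ.+ g i) ≡ Σ≤ n f ℤ.+ Σ≤ n g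
Σ≤-+ zero f g = refl
Σ≤-+ (suc n) f g = trans (cong (ℤ._+ (f (suc n) ℤ.+ g (suc n))) (Σ≤-+ n f g))
  (interchange (Σ≤ n f) (Σ≤ n g) (f (suc n)) (g (suc n)))
  where
  interchange : ∀ a b c d → (a ℤ.+ b) ℤ.+ (c ℤ.+ d) ≡ (a ℤ.+ c) ℤ.+ (b ℤ.+ d)
  interchange = ℤ-Solver.solve-∀

Σ≤-*ˡ : ∀ n c (f : ℕ → ℤ) → Σ≤ n (λ i → c ℤ.* f i) ≡ c ℤ.* Σ≤ n f
Σ≤-*ˡ zero c f = refl
Σ≤-*ˡ (suc n) c f = trans (cong (ℤ._+ c ℤ.* f (suc n)) (Σ≤-*ˡ n c f)) (sym (ℤ.*-distribˡ-+ c _ _))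

Σ≤-shift : (φ : ℕ → ℕ → ℤ) → (∀ i → φ i 0 ≡ 0ℤ) →
  ∀ n → Σ≤ (suc n) (λ i → φ i (suc n ∸ i)) ≡ Σ≤ n (λ i → φ i (suc (n ∸ i)))
Σ≤-shift φ φ0 n = begin
  Σ≤ n (λ i → φ i (suc n ∸ i)) ℤ.+ φ (suc n) (n ∸ n)
    ≡⟨ cong₂ ℤ._+_ (Σ≤-cong n λ i i≤n → cong (φ i) (ℕ.+-∸-assoc 1 i≤n))
                   (trans (cong (φ (suc n)) (ℕ.n∸n≡0 n)) (φ0 (suc n))) ⟩
  Σ≤ n (λ i → φ i (suc (n ∸ i))) ℤ.+ 0ℤ
    ≡⟨ ℤ.+-identityʳ _ ⟩
  Σ≤ n (λ i → φ i (suc (n ∸ i))) ∎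
  where open ≡-Reasoning

⊛-congʳ : ∀ f {g h} → g ≐ h → f ⊛ g ≐ f ⊛ h
⊛-congʳ f g≐h .coeff N K = Σ≤-cong N λ i _ → Σ≤-cong K λ j _ → cong (f i j ℤ.*_) (coeff g≐h (N ∸ i) (K ∸ j))

⊛-distribʳ : ∀ f g h → f ⊛ (g ⊕ h) ≐ f ⊛ g ⊕ f ⊛ h
⊛-distribʳ f g h .coeff N K = trans
  (Σ≤-cong N λ i _ → trans (Σ≤-cong K λ j _ → ℤ.*-distribˡ-+ (f i j) _ _) (Σ≤-+ K _ _))
  (Σ≤-+ N _ _)

⊛-◃ʳ : ∀ f c g → f ⊛ (c ◃ g) ≐ c ◃ (f ⊛ g)
⊛-◃ʳ f c g .coeff N K = trans
  (Σ≤-cong N λ i _ → trans (Σ≤-cong K λ j _ → swap (f i j) c _) (Σ≤-*ˡ K c _))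
  (Σ≤-*ˡ N c _)
  where
  swap : ∀ a c b → a ℤ.* (c ℤ.* b) ≡ c ℤ.* (a ℤ.* b)
  swap = ℤ-Solver.solve-∀

⊛-x·ʳ : ∀ f g → f ⊛ x· g ≐ x· (f ⊛ g)
⊛-x·ʳ f g .coeff zero K = Σ≤-zero K λ j _ → ℤ.*-zeroʳ (f 0 j)
⊛-x·ʳ f g .coeff (suc N) K =
  Σ≤-shift (λ i M → Σ≤ K λ j → f i j ℤ.* (x· g) M (K ∸ j)) (λ i → Σ≤-zero K λ j _ → ℤ.*-zeroʳ (f i j)) N

⊛-t·ʳ : ∀ f g → f ⊛ t· g ≐ t· (f ⊛ g)
⊛-t·ʳ f g .coeff N zero = Σ≤-zero N λ i _ → ℤ.*-zeroʳ (f i 0)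
⊛-t·ʳ f g .coeff N (suc K) =
  Σ≤-cong N λ i _ → Σ≤-shift (λ j M → f i j ℤ.* (t· g) (N ∸ i) M) (λ j → ℤ.*-zeroʳ (f i j)) K

const-offˡ : ∀ c {N} K → 0 ℕ.< N → const c N K ≡ 0ℤ
const-offˡ c K (s≤s _) = refl

const-offʳ : ∀ c N {K} → 0 ℕ.< K → const c N K ≡ 0ℤ
const-offʳ c zero (s≤s _) = refl
const-offʳ c (suc N) (s≤s _) = refl

⊛-constʳ : ∀ f c → f ⊛ const c ≐ c ◃ f
⊛-constʳ f c .coeff N K = begin
  Σ≤ N (λ i → Σ≤ K λ j → f i j ℤ.* const c (N ∸ i) (K ∸ j))
    ≡⟨ Σ≤-last N (λ i i<N → Σ≤-zero K λ j _ → vanish (f i j) (const-offˡ c (K ∸ j) (ℕ.m<n⇒0<n∸m i<N))) ⟩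
  Σ≤ K (λ j → f N j ℤ.* const c (N ∸ N) (K ∸ j))
    ≡⟨ Σ≤-last K (λ j j<K → vanish (f N j) (const-offʳ c (N ∸ N) (ℕ.m<n⇒0<n∸m j<K))) ⟩
  f N K ℤ.* const c (N ∸ N) (K ∸ K)
    ≡⟨ cong₂ (λ N′ K′ → f N K ℤ.* const c N′ K′) (ℕ.n∸n≡0 N) (ℕ.n∸n≡0 K) ⟩
  f N K ℤ.* c
    ≡⟨ ℤ.*-comm (f N K) c ⟩
  c ℤ.* f N K ∎
  where
  open ≡-Reasoning
  vanish : ∀ a {b} → b ≡ 0ℤ → a ℤ.* b ≡ 0ℤ
  vanish a refl = ℤ.*-zeroʳ a

⊛-identityʳ : ∀ f → f ⊛ const 1ℤ ≐ f
⊛-identityʳ f .coeff N K = trans (coeff (⊛-constʳ f 1ℤ) N K) (ℤ.*-identityˡ (f N K))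

X≐x·1 : X ≐ x· const 1ℤ
X≐x·1 .coeff zero K = refl
X≐x·1 .coeff (suc zero) zero = refl
X≐x·1 .coeff (suc zero) (suc K) = refl
X≐x·1 .coeff (suc (suc N)) K = refl

T≐t·1 : T ≐ t· const 1ℤ
T≐t·1 .coeff zero zero = refl
T≐t·1 .coeff zero (suc zero) = refl
T≐t·1 .coeff zero (suc (suc K)) = refl
T≐t·1 .coeff (suc N) zero = refl
T≐t·1 .coeff (suc N) (suc K) = refl

module ≐-Reasoning = Relation.Binary.Reasoning.Setoid ≐-setoid

⊛-X : ∀ f → f ⊛ X ≐ x· f
⊛-X f = begin
  f ⊛ X                ≈⟨ ⊛-congʳ f X≐x·1 ⟩
  f ⊛ x· const 1ℤ      ≈⟨ ⊛-x·ʳ f (const 1ℤ) ⟩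
  x· (f ⊛ const 1ℤ)    ≈⟨ x·-cong (⊛-identityʳ f) ⟩
  x· f                 ∎
  where open ≐-Reasoning

⊛-T : ∀ f → f ⊛ T ≐ t· f
⊛-T f = begin
  f ⊛ T                ≈⟨ ⊛-congʳ f T≐t·1 ⟩
  f ⊛ t· const 1ℤ      ≈⟨ ⊛-t·ʳ f (const 1ℤ) ⟩
  t· (f ⊛ const 1ℤ)    ≈⟨ t·-cong (⊛-identityʳ f) ⟩
  t· f                 ∎
  where open ≐-Reasoning

1-tx : FPS
1-tx = const (+ 1) ⊕ const (- (+ 1)) ⊛ T ⊛ X

1-3x+x² : FPS
1-3x+x² = const (+ 1) ⊕ const (- (+ 3)) ⊛ X ⊕ X ⊛ X

tx-2tx²+t²x³ : FPS
tx-2tx²+t²x³ = T ⊛ X ⊕ const (- (+ 2)) ⊛ T ⊛ X ⊛ X ⊕ T ⊛ T ⊛ X ⊛ X ⊛ X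

times[1-tx] : FPS → FPS
times[1-tx] f = f ⊕ x· t· (- (+ 1)) ◃ f

times[1-3x+x²] : FPS → FPS
times[1-3x+x²] f = f ⊕ x· (- (+ 3)) ◃ f ⊕ x· x· f

times[1-3x+x²]-cong : ∀ {f g} → f ≐ g → times[1-3x+x²] f ≐ times[1-3x+x²] g
times[1-3x+x²]-cong f≐g = ⊕-cong (⊕-cong f≐g (x·-cong (◃-cong (- (+ 3)) f≐g))) (x·-cong (x·-cong f≐g))

module ≐ = Setoid ≐-setoid

⊛-X-≐ : ∀ {f g} → f ≐ g → f ⊛ X ≐ x· g
⊛-X-≐ {f} f≐g = ≐.trans (⊛-X f) (x·-cong f≐g)

⊛-1-tx : ∀ f → f ⊛ 1-tx ≐ times[1-tx] f
⊛-1-tx f = begin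
  f ⊛ (const (+ 1) ⊕ c ⊛ T ⊛ X)
    ≈⟨ ⊛-distribʳ f (const (+ 1)) (c ⊛ T ⊛ X) ⟩
  f ⊛ const (+ 1) ⊕ f ⊛ (c ⊛ T ⊛ X)
    ≈⟨ ⊕-cong (⊛-identityʳ f) (⊛-congʳ f (⊛-X-≐ (⊛-T c))) ⟩
  f ⊕ f ⊛ x· t· c
    ≈⟨ ⊕-cong (≐.refl {f}) (≐.trans (⊛-x·ʳ f (t· c)) (x·-cong (⊛-t·ʳ f c))) ⟩
  f ⊕ x· t· (f ⊛ c)
    ≈⟨ ⊕-cong (≐.refl {f}) (x·-cong (t·-cong (⊛-constʳ f (- (+ 1))))) ⟩
  times[1-tx] f ∎
  where
  open ≐-Reasoning
  c = const (- (+ 1))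

⊛-1-3x+x² : ∀ f → f ⊛ 1-3x+x² ≐ times[1-3x+x²] f
⊛-1-3x+x² f = begin
  f ⊛ ((const (+ 1) ⊕ c ⊛ X) ⊕ X ⊛ X)
    ≈⟨ ⊛-distribʳ f (const (+ 1) ⊕ c ⊛ X) (X ⊛ X) ⟩
  f ⊛ (const (+ 1) ⊕ c ⊛ X) ⊕ f ⊛ (X ⊛ X)
    ≈⟨ ⊕-cong (⊛-distribʳ f (const (+ 1)) (c ⊛ X)) (≐.refl {f ⊛ (X ⊛ X)}) ⟩
  f ⊛ const (+ 1) ⊕ f ⊛ (c ⊛ X) ⊕ f ⊛ (X ⊛ X)
    ≈⟨ ⊕-cong (⊕-cong (⊛-identityʳ f) (⊛-congʳ f (⊛-X c))) (⊛-congʳ f (⊛-X X)) ⟩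
  f ⊕ f ⊛ x· c ⊕ f ⊛ x· X
    ≈⟨ ⊕-cong (⊕-cong (≐.refl {f}) (⊛-x·ʳ f c)) (⊛-x·ʳ f X) ⟩
  f ⊕ x· (f ⊛ c) ⊕ x· (f ⊛ X)
    ≈⟨ ⊕-cong (⊕-cong (≐.refl {f}) (x·-cong (⊛-constʳ f (- (+ 3))))) (x·-cong (⊛-X f)) ⟩
  times[1-3x+x²] f ∎
  where
  open ≐-Reasoning
  c = const (- (+ 3))

⊛-times[1-3x+x²] : ∀ g f → g ⊛ times[1-3x+x²] f ≐ times[1-3x+x²] (g ⊛ f)
⊛-times[1-3x+x²] g f = begin
  g ⊛ (f ⊕ x· c ◃ f ⊕ x· x· f)
    ≈⟨ ⊛-distribʳ g (f ⊕ x· c ◃ f) (x· x· f) ⟩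
  g ⊛ (f ⊕ x· c ◃ f) ⊕ g ⊛ x· x· f
    ≈⟨ ⊕-cong (⊛-distribʳ g f (x· c ◃ f)) (≐.trans (⊛-x·ʳ g (x· f)) (x·-cong (⊛-x·ʳ g f))) ⟩
  g ⊛ f ⊕ g ⊛ x· c ◃ f ⊕ x· x· (g ⊛ f)
    ≈⟨ ⊕-cong (⊕-cong (≐.refl {g ⊛ f}) (≐.trans (⊛-x·ʳ g (c ◃ f)) (x·-cong (⊛-◃ʳ g c f))))
              (≐.refl {x· x· (g ⊛ f)}) ⟩
  times[1-3x+x²] (g ⊛ f) ∎
  where
  open ≐-Reasoning
  c = - (+ 3)

numerator≐ : tx-2tx²+t²x³ ≐ x· T ⊕ x· x· t· const (- (+ 2)) ⊕ x· x· x· t· T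
numerator≐ = ⊕-cong (⊕-cong (⊛-X T) (⊛-X-≐ (⊛-X-≐ (⊛-T (const (- (+ 2)))))))
                    (⊛-X-≐ (⊛-X-≐ (⊛-X-≐ (⊛-T T))))

-- The generating function

-- (1 - tx) g
twoColumns : FPS
twoColumns (suc N) 1 = + #Av N
twoColumns (suc (suc N)) 2 = + #U N
twoColumns _ _ = 0ℤ

#Av-recurrence : ∀ n → #Av (2 + n) + #Av n ≡ 3 * #Av (1 + n)
#Av-recurrence n = identity (#Av n) (#U n)
  where
  identity : ∀ a u → ((a + u) + ((a + u) + u)) + a ≡ 3 * (a + u)
  identity = solve-∀

#U-recurrence : ∀ n → #U (2 + n) + #U n ≡ 3 * #U (1 + n)
#U-recurrence n = identity (#Av n) (#U n)
  where
  identity : ∀ a u → (((a + u) + ((a + u) + u)) + ((a + u) + u)) + u ≡ 3 * ((a + u) + u)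
  identity = solve-∀

three-term : ∀ a b c → a + c ≡ 3 * b → (+ a ℤ.+ - (+ 3) ℤ.* + b) ℤ.+ + c ≡ 0ℤ
three-term a b c a+c≡3b = begin
  (+ a ℤ.+ - (+ 3) ℤ.* + b) ℤ.+ + c  ≡⟨ regroup (+ a) (+ b) (+ c) ⟩
  (+ a ℤ.+ + c) ℤ.- + 3 ℤ.* + b      ≡⟨ cong₂ ℤ._-_ (cong +_ a+c≡3b) (sym (ℤ.pos-* 3 b)) ⟩
  + (3 * b) ℤ.- + (3 * b)            ≡⟨ ℤ.+-inverseʳ (+ (3 * b)) ⟩
  0ℤ                                 ∎
  where
  open ≡-Reasoning
  regroup : ∀ x y z → (x ℤ.+ - (+ 3) ℤ.* y) ℤ.+ z ≡ (x ℤ.+ z) ℤ.- + 3 ℤ.* y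
  regroup = ℤ-Solver.solve-∀

times[1-3x+x²]-twoColumns : times[1-3x+x²] twoColumns ≐ x· T ⊕ x· x· t· const (- (+ 2)) ⊕ x· x· x· t· T
times[1-3x+x²]-twoColumns .coeff zero K = refl
times[1-3x+x²]-twoColumns .coeff 1 0 = refl
times[1-3x+x²]-twoColumns .coeff 1 1 = refl
times[1-3x+x²]-twoColumns .coeff 1 2 = refl
times[1-3x+x²]-twoColumns .coeff 1 (suc (suc (suc K))) = refl
times[1-3x+x²]-twoColumns .coeff 2 0 = refl
times[1-3x+x²]-twoColumns .coeff 2 1 = refl
times[1-3x+x²]-twoColumns .coeff 2 2 = refl
times[1-3x+x²]-twoColumns .coeff 2 (suc (suc (suc K))) = refl
times[1-3x+x²]-twoColumns .coeff 3 0 = refl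
times[1-3x+x²]-twoColumns .coeff 3 1 = refl
times[1-3x+x²]-twoColumns .coeff 3 2 = refl
times[1-3x+x²]-twoColumns .coeff 3 (suc (suc (suc K))) = refl
times[1-3x+x²]-twoColumns .coeff (suc (suc (suc (suc N)))) 0 = refl
times[1-3x+x²]-twoColumns .coeff (suc (suc (suc (suc N)))) 1 =
  three-term (#Av (3 + N)) (#Av (2 + N)) (#Av (1 + N)) (#Av-recurrence (suc N))
times[1-3x+x²]-twoColumns .coeff (suc (suc (suc (suc N)))) 2 =
  three-term (#U (2 + N)) (#U (1 + N)) (#U N) (#U-recurrence N)
times[1-3x+x²]-twoColumns .coeff (suc (suc (suc (suc N)))) (suc (suc (suc K))) = refl

Counts : (ℕ → ℕ → ℕ) → Set
Counts a = (n k : ℕ) → 1 ≤ k → k ≤ n → Σ (Fin n) (λ kk → suc (toℕ kk) ≡ k × (Fin (a n k) ↔ S n kk))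

module _ {a : ℕ → ℕ → ℕ} (counts : Counts a) where

  count-at : ∀ n (kk : Fin n) → Fin (a n (suc (toℕ kk))) ↔ S n kk
  count-at n kk with counts n (suc (toℕ kk)) (s≤s z≤n) (Fin.toℕ<n kk)
  ... | kk′ , 1+kk′≡1+kk , a↔S with refl ← Fin.toℕ-injective (ℕ.suc-injective 1+kk′≡1+kk) = a↔S

  a-column1 : ∀ n → a (suc n) 1 ≡ #Av n
  a-column1 n = ↔⇒≡ (↔-trans (count-at (suc n) zero) (↔-trans (S-at-1↔Av n) (↔-sym (Av-count n))))

  a-column2 : ∀ n → a (2 + n) 2 ≡ #Av (suc n)
  a-column2 n = ↔⇒≡ (↔-trans (count-at (2 + n) (suc zero)) (↔-trans (S-at-2↔Av n) (↔-sym (Av-count (suc n)))))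

  a-diagonal : ∀ n K → K ℕ.< n → a (2 + n) (3 + K) ≡ a (1 + n) (2 + K)
  a-diagonal n K K<n with kk ← fromℕ< K<n | refl ← Fin.toℕ-fromℕ< K<n =
    ↔⇒≡ (↔-trans (count-at (2 + n) (suc (suc kk))) (↔-trans (S-shift-↔ n kk) (↔-sym (count-at (suc n) (suc kk)))))

  -- Both coefficients are guarded by the same test K <ᵇ N.
  gSeries-diagonal : ∀ N K → gSeries a (2 + N) (3 + K) ≡ gSeries a (1 + N) (2 + K)
  gSeries-diagonal N K with K <ᵇ N in K<ᵇN
  ... | true = cong +_ (a-diagonal N K (ℕ.<ᵇ⇒< K N (subst Bool.T (sym K<ᵇN) tt)))
  ... | false = refl

  times[1-tx]-gSeries : times[1-tx] (gSeries a) ≐ twoColumns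
  times[1-tx]-gSeries .coeff zero K = refl
  times[1-tx]-gSeries .coeff (suc N) zero = refl
  times[1-tx]-gSeries .coeff 1 1 = trans (ℤ.+-identityʳ _) (cong +_ (a-column1 0))
  times[1-tx]-gSeries .coeff (suc (suc N)) 1 = trans (ℤ.+-identityʳ _) (cong +_ (a-column1 (suc N)))
  times[1-tx]-gSeries .coeff 1 2 = refl
  times[1-tx]-gSeries .coeff (suc (suc N)) 2 = begin
    + a (2 + N) 2 ℤ.+ - (+ 1) ℤ.* + a (1 + N) 1   ≡⟨ cong₂ (λ p q → + p ℤ.+ - (+ 1) ℤ.* + q) (a-column2 N) (a-column1 N) ⟩
    + (#Av N + #U N) ℤ.+ - (+ 1) ℤ.* + #Av N     ≡⟨ cancel (+ #Av N) (+ #U N) ⟩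
    + #U N                                       ∎
    where
    open ≡-Reasoning
    cancel : ∀ p u → (p ℤ.+ u) ℤ.+ - (+ 1) ℤ.* p ≡ u
    cancel = ℤ-Solver.solve-∀
  times[1-tx]-gSeries .coeff 1 (suc (suc (suc K))) = refl
  times[1-tx]-gSeries .coeff (suc (suc N)) (suc (suc (suc K))) = begin
    gSeries a (2 + N) (3 + K) ℤ.+ - (+ 1) ℤ.* g  ≡⟨ cong (ℤ._+ - (+ 1) ℤ.* g) (gSeries-diagonal N K) ⟩
    g ℤ.+ - (+ 1) ℤ.* g                          ≡⟨ cancel g ⟩
    0ℤ                                           ∎
    where
    open ≡-Reasoning
    g = gSeries a (1 + N) (2 + K)
    cancel : ∀ p → p ℤ.+ - (+ 1) ℤ.* p ≡ 0ℤ
    cancel = ℤ-Solver.solve-∀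

  generating-function : gSeries a ⊛ (1-tx ⊛ 1-3x+x²) ≐ tx-2tx²+t²x³
  generating-function = begin
    gSeries a ⊛ (1-tx ⊛ 1-3x+x²)                      ≈⟨ ⊛-congʳ (gSeries a) (⊛-1-3x+x² 1-tx) ⟩
    gSeries a ⊛ times[1-3x+x²] 1-tx                   ≈⟨ ⊛-times[1-3x+x²] (gSeries a) 1-tx ⟩
    times[1-3x+x²] (gSeries a ⊛ 1-tx)                 ≈⟨ times[1-3x+x²]-cong (⊛-1-tx (gSeries a)) ⟩
    times[1-3x+x²] (times[1-tx] (gSeries a))          ≈⟨ times[1-3x+x²]-cong times[1-tx]-gSeries ⟩
    times[1-3x+x²] twoColumns                         ≈⟨ times[1-3x+x²]-twoColumns ⟩
    x· T ⊕ x· x· t· const (- (+ 2)) ⊕ x· x· x· t· T   ≈⟨ ≐.sym numerator≐ ⟩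
    tx-2tx²+t²x³                                      ∎
    where open ≐-Reasoning

mainTheorem6 : ((m : ℕ) → (Fin (F (2 * (suc (suc m)) ∸ 3)) ↔ S (suc (suc m)) zero)
             × (Fin (F (2 * (suc (suc m)) ∸ 3)) ↔ S (suc (suc m)) (Data.Fin.suc zero)))
    × ((m : ℕ) → (k : Fin m) → S (suc (suc m)) (Data.Fin.suc (Data.Fin.suc k)) ↔ S (suc m) (Data.Fin.suc k))
    × ((a : ℕ → ℕ → ℕ) →
       ((n k : ℕ) → (1k : 1 ≤ k) → (kn : k ≤ n) → Σ (Fin n) (λ kk → suc (toℕ kk) ≡ k × (Fin (a n k) ↔ S n kk))) →
       (N K : ℕ) →
         (gSeries a ⊛ ((const (+ 1) ⊕ const (- (+ 1)) ⊛ T ⊛ X) ⊛ (const (+ 1) ⊕ const (- (+ 3)) ⊛ X ⊕ X ⊛ X))) N K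
         ≡ (T ⊛ X ⊕ const (- (+ 2)) ⊛ T ⊛ X ⊛ X ⊕ T ⊛ T ⊛ X ⊛ X ⊛ X) N K)
mainTheorem6 =
  (λ m → ↔-trans (Av-count-F m) (↔-sym (S-at-1↔Av (suc m))) , ↔-trans (Av-count-F m) (↔-sym (S-at-2↔Av m))) ,
  S-shift-↔ ,
  λ a counts → coeff (generating-function counts)
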